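{- Let $m\ge2$, $k\ge1$, $g\ge0$ and $n=m+g(m-1)$. Every $k$-equivalence class of $(m-1)$-Dyck paths of length $n-1$ contains a unique $k$-minimal path.
   Context: $N$ denotes the unit step $(1,1)$, $S$ the step $(1,-1)$; lattice paths are identified with words in $N,S$. An $(m-1)$-Dyck path is a lattice path from $(0,0)$ with up-steps $(m-1,m-1)$ and down-steps $(1,-1)$, never below the $x$-axis and ending on it; its length is its number of down-steps. Right $k$-compression: replace a consecutive subword $X=N^{m-1}D_1SD_2S\dots D_{j-1}SN^{k(m-1)}D_jSD_{j+1}S\dots SD_{m+k(m-1)}$ ($1\le j\le m-1$, each $D_i$ a possibly empty word that is an $(m-1)$-Dyck path up to translation) by $X'=N^{m-1}D_1S\dots D_{j-1}SD_jSN^{k(m-1)}D_{j+1}S\dots SD_{m+k(m-1)}$; left $k$-compression is the inverse. Write $D'\preceq_k D$ if $D$ is obtained from $D'$ by finitely many right $k$-compressions. Two paths are $k$-equivalent if one is obtained from the other by a finite sequence of right and left $k$-compressions. $D$ is $k$-minimal if there is no path $D'\ne D$ of the same length with $D'\preceq_k D$. -}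

module Defs where

open import Data.Nat using (ℕ; zero; suc; _+_; _*_; _∸_; _≤_)
open import Data.List using (List; []; _∷_; _++_; replicate; concat; map; take; drop; length; intersperse)
open import Data.Product using (Σ; ∃; _×_; _,_)
open import Data.Empty using (⊥)
open import Data.Unit using (⊤)
open import Relation.Binary.PropositionalEquality using (_≡_; _≢_)
open import Relation.Binary.Construct.Closure.ReflexiveTransitive using (Star)
open import Relation.Binary.Construct.Closure.Equivalence using (EqClosure)

-- Unit lattice steps: N = (1,1), S = (1,-1).  Lattice paths are words.
data Step : Set where
  N S : Step

Word : Set
Word = List Step

-- Steps of an (m-1)-Dyck path: U = up-step (m-1,m-1), D = down-step (1,-1).
data BigStep : Set where
  U D : BigStep

expand : ℕ → List BigStep → Word
expand m []       = []
expand m (U ∷ bs) = replicate (m ∸ 1) N ++ expand m bs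
expand m (D ∷ bs) = S ∷ expand m bs

Valid : ℕ → ℕ → List BigStep → Set
Valid m h       []       = h ≡ 0
Valid m h       (U ∷ bs) = Valid m (h + (m ∸ 1)) bs
Valid m zero    (D ∷ bs) = ⊥
Valid m (suc h) (D ∷ bs) = Valid m h bs

IsDyck : ℕ → Word → Set
IsDyck m w = Σ (List BigStep) λ bs → Valid m 0 bs × expand m bs ≡ w

-- number of S-steps (= number of down-steps = length of a Dyck path)
countS : Word → ℕ
countS []      = 0
countS (N ∷ w) = countS w
countS (S ∷ w) = suc (countS w)

joinS : List Word → Word
joinS ds = concat (intersperse (S ∷ []) ds)

catS : List Word → Word
catS ds = concat (map (λ d → d ++ (S ∷ [])) ds)

AllDyck : ℕ → List Word → Set
AllDyck m []       = ⊤
AllDyck m (d ∷ ds) = IsDyck m d × AllDyck m ds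

-- X  = N^{m-1} D_1 S ... D_{j-1} S N^{k(m-1)} D_j S D_{j+1} S ... S D_{m+k(m-1)}
compX : ℕ → ℕ → ℕ → List Word → Word
compX m k j ds = replicate (m ∸ 1) N ++ catS (take (j ∸ 1) ds)
                 ++ replicate (k * (m ∸ 1)) N ++ joinS (drop (j ∸ 1) ds)

-- X' = N^{m-1} D_1 S ... D_{j-1} S D_j S N^{k(m-1)} D_{j+1} S ... S D_{m+k(m-1)}
compX' : ℕ → ℕ → ℕ → List Word → Word
compX' m k j ds = replicate (m ∸ 1) N ++ catS (take j ds)
                  ++ replicate (k * (m ∸ 1)) N ++ joinS (drop j ds)

data RightComp (m k : ℕ) : Word → Word → Set where
  rcomp : (u v : Word) (j : ℕ) (ds : List Word) →
          1 ≤ j → j ≤ m ∸ 1 →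
          length ds ≡ m + k * (m ∸ 1) →
          AllDyck m ds →
          RightComp m k (u ++ compX m k j ds ++ v) (u ++ compX' m k j ds ++ v)

Preceq : ℕ → ℕ → Word → Word → Set
Preceq m k P' P = Star (RightComp m k) P' P

-- k-equivalence: finite sequence of right and left k-compressions
KEquiv : ℕ → ℕ → Word → Word → Set
KEquiv m k = EqClosure (RightComp m k)

KMinimal : ℕ → ℕ → Word → Set
KMinimal m k P = (P' : Word) → IsDyck m P' → countS P' ≡ countS P →
                 Preceq m k P' P → P' ≡ P

-- Let K = k(m − 1). A right k-compression only moves a block N^K to the right past a
-- subpath D_j S, so the residues mod K of the numbers of N's preceding the S's are an
-- invariant of k-equivalence. Every right compression creates a factor S N^K, so a Dyck
-- path without that factor is k-minimal. Conversely, a Dyck path with a factor S N^K is a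
-- right compression of another Dyck path: the last up-step reaching the height of that S
-- supplies the N^{m−1} D₁ S … D_j S, and the N^K moves back in front of D_j S. This raises
-- the area Σ_S #{N's before S}, which is at most n², so repeating it reaches a path without
-- S N^K in the same class; hence the k-minimal paths are exactly those. Such a path is
-- N^{a₀} S N^{a₁} S … N^{a_r} S with a_i < K for i ≥ 1, so its residues determine a₁, …, a_r
-- and the balance #N = #S determines a₀: the k-minimal path of a class is unique.

module Submission where

open import Defs
open import Data.Empty using (⊥)
open import Data.List using (List; []; _∷_; _++_; replicate; map; take; drop; length)
open import Data.List.Properties
  using (++-monoid; ++-assoc; ++-identityʳ; ++-conicalʳ; ++-cancelˡ; ∷-injectiveˡ; ∷-injectiveʳ; length-++; length-map)
open import Algebra.Solver.Monoid (++-monoid Step) using (solve; _⊜_; _⊕_)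
open import Data.List.Relation.Binary.Infix.Heterogeneous using (Infix; _++ⁱ_; toView; fromView; MkView)
open import Data.List.Relation.Binary.Infix.Heterogeneous.Properties using (infix?)
open import Data.List.Relation.Binary.Pointwise using (Pointwise-≡⇒≡; ≡⇒Pointwise-≡)
open import Data.List.Relation.Unary.All using (All; []; _∷_)
open import Data.Nat using (ℕ; zero; suc; _+_; _*_; _∸_; _≤_; _<_; s≤s; z≤n; z<s; NonZero; pred)
open import Data.Nat.DivMod using (_%_; %-distribˡ-+; [m+n]%n≡m%n; [m+kn]%n≡m%n; m<n⇒m%n≡m)
open import Data.Nat.Properties hiding (_≟_)
open import Algebra.Properties.CommutativeSemigroup +-commutativeSemigroup using (xy∙z≈xz∙y)
open import Data.Nat.Tactic.RingSolver using (solve-∀)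
open import Data.Product using (Σ; ∃; ∃₂; _×_; _,_)
open import Data.Sum using (_⊎_; inj₁; inj₂)
open import Data.Unit using (tt)
open import Function using (case_of_)
open import Relation.Binary.Construct.Closure.Equivalence using (gfold)
open import Relation.Binary.Construct.Closure.ReflexiveTransitive using (Star; ε; _◅_)
open import Relation.Binary.Construct.Closure.Symmetric using (bwd)
open import Relation.Binary.Definitions using (DecidableEquality)
open import Relation.Binary.PropositionalEquality
open import Relation.Nullary using (¬_; Dec; yes; no; contradiction)

infix 10 N^_

N^_ : ℕ → Word
N^ n = replicate n N

N^-+ : ∀ a b → N^ (a + b) ≡ N^ a ++ N^ b
N^-+ zero    b = refl
N^-+ (suc a) b = cong (N ∷_) (N^-+ a b)

countN : Word → ℕ
countN []      = 0
countN (N ∷ w) = suc (countN w)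
countN (S ∷ w) = countN w

countN-++ : ∀ x y → countN (x ++ y) ≡ countN x + countN y
countN-++ []      y = refl
countN-++ (N ∷ x) y = cong suc (countN-++ x y)
countN-++ (S ∷ x) y = countN-++ x y

countS-++ : ∀ x y → countS (x ++ y) ≡ countS x + countS y
countS-++ []      y = refl
countS-++ (N ∷ x) y = countS-++ x y
countS-++ (S ∷ x) y = cong suc (countS-++ x y)

countN-N^-++ : ∀ a y → countN (N^ a ++ y) ≡ a + countN y
countN-N^-++ zero    y = refl
countN-N^-++ (suc a) y = cong suc (countN-N^-++ a y)

countS-N^-++ : ∀ a y → countS (N^ a ++ y) ≡ countS y
countS-N^-++ zero    y = refl
countS-N^-++ (suc a) y = countS-N^-++ a y

0<countS-++S : ∀ a → 0 < countS (a ++ S ∷ [])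
0<countS-++S []      = z<s
0<countS-++S (N ∷ a) = 0<countS-++S a
0<countS-++S (S ∷ a) = z<s

catS-take++joinS-drop : ∀ i ds → i < length ds → catS (take i ds) ++ joinS (drop i ds) ≡ joinS ds
catS-take++joinS-drop zero    ds           _       = refl
catS-take++joinS-drop (suc i) (d ∷ [])     (s≤s ())
catS-take++joinS-drop (suc i) (d ∷ e ∷ ds) (s≤s i<) = begin
  ((d ++ S ∷ []) ++ catS (take i (e ∷ ds))) ++ joinS (drop i (e ∷ ds)) ≡⟨ ++-assoc (d ++ S ∷ []) _ _ ⟩
  (d ++ S ∷ []) ++ catS (take i (e ∷ ds)) ++ joinS (drop i (e ∷ ds))   ≡⟨ cong ((d ++ S ∷ []) ++_) (catS-take++joinS-drop i (e ∷ ds) i<) ⟩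
  (d ++ S ∷ []) ++ joinS (e ∷ ds)                                       ≡⟨ ++-assoc d (S ∷ []) _ ⟩
  d ++ S ∷ joinS (e ∷ ds)                                               ∎
  where open ≡-Reasoning

catS-∷-endsInS : ∀ x xs → ∃ λ A → catS (x ∷ xs) ≡ A ++ S ∷ []
catS-∷-endsInS x []       = x , ++-identityʳ (x ++ S ∷ [])
catS-∷-endsInS x (y ∷ ys) =
  let A , eq = catS-∷-endsInS y ys in
  (x ++ S ∷ []) ++ A , trans (cong ((x ++ S ∷ []) ++_) eq) (sym (++-assoc (x ++ S ∷ []) A _))

take-length-++ : ∀ {A : Set} (xs ys : List A) → take (length xs) (xs ++ ys) ≡ xs
take-length-++ []       ys = refl
take-length-++ (x ∷ xs) ys = cong (x ∷_) (take-length-++ xs ys)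

drop-length-++ : ∀ {A : Set} (xs ys : List A) → drop (length xs) (xs ++ ys) ≡ ys
drop-length-++ []       ys = refl
drop-length-++ (x ∷ xs) ys = drop-length-++ xs ys

take-suc-length-++ : ∀ {A : Set} (xs : List A) y ys → take (suc (length xs)) (xs ++ y ∷ ys) ≡ xs ++ y ∷ []
take-suc-length-++ []       y ys = refl
take-suc-length-++ (x ∷ xs) y ys = cong (x ∷_) (take-suc-length-++ xs y ys)

drop-suc-length-++ : ∀ {A : Set} (xs : List A) y ys → drop (suc (length xs)) (xs ++ y ∷ ys) ≡ ys
drop-suc-length-++ []       y ys = refl
drop-suc-length-++ (x ∷ xs) y ys = drop-suc-length-++ xs y ys

catS-snoc : ∀ ds d → catS (ds ++ d ∷ []) ≡ catS ds ++ d ++ S ∷ []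
catS-snoc []       d = ++-identityʳ _
catS-snoc (e ∷ ds) d = trans (cong ((e ++ S ∷ []) ++_) (catS-snoc ds d)) (sym (++-assoc (e ++ S ∷ []) (catS ds) _))

joinS-++[] : ∀ ds → joinS (ds ++ [] ∷ []) ≡ catS ds
joinS-++[] []           = refl
joinS-++[] (d ∷ [])     = sym (++-identityʳ _)
joinS-++[] (d ∷ e ∷ ds) = trans (cong (λ t → d ++ S ∷ t) (joinS-++[] (e ∷ ds))) (sym (++-assoc d (S ∷ []) _))

joinS-∷-++[] : ∀ d ds → joinS (d ∷ ds ++ [] ∷ []) ≡ d ++ S ∷ catS ds
joinS-∷-++[] d []       = refl
joinS-∷-++[] d (e ∷ ds) = cong (λ t → d ++ S ∷ t) (joinS-++[] (e ∷ ds))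

compX'-shape : ∀ m k As a Bs → compX' m k (suc (length As)) (As ++ a ∷ Bs ++ [] ∷ [])
                              ≡ (N^ (m ∸ 1) ++ catS As) ++ (a ++ S ∷ []) ++ N^ (k * (m ∸ 1)) ++ catS Bs
compX'-shape m k As a Bs = begin
  p ++ catS (take (suc (length As)) ds) ++ n ++ joinS (drop (suc (length As)) ds)
    ≡⟨ cong₂ (λ t d → p ++ catS t ++ n ++ joinS d) (take-suc-length-++ As a _) (drop-suc-length-++ As a _) ⟩
  p ++ catS (As ++ a ∷ []) ++ n ++ joinS (Bs ++ [] ∷ [])
    ≡⟨ cong₂ (λ t d → p ++ t ++ n ++ d) (catS-snoc As a) (joinS-++[] Bs) ⟩
  p ++ (catS As ++ a ++ S ∷ []) ++ n ++ catS Bs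
    ≡⟨ solve 6 (λ p c a s n b → p ⊕ ((c ⊕ (a ⊕ s)) ⊕ (n ⊕ b)) ⊜ (p ⊕ c) ⊕ ((a ⊕ s) ⊕ (n ⊕ b))) refl p (catS As) a (S ∷ []) n (catS Bs) ⟩
  (p ++ catS As) ++ (a ++ S ∷ []) ++ n ++ catS Bs ∎
  where
  open ≡-Reasoning
  p = N^ (m ∸ 1)
  n = N^ (k * (m ∸ 1))
  ds = As ++ a ∷ Bs ++ [] ∷ []

compX-shape : ∀ m k As a Bs → compX m k (suc (length As)) (As ++ a ∷ Bs ++ [] ∷ [])
                             ≡ (N^ (m ∸ 1) ++ catS As) ++ N^ (k * (m ∸ 1)) ++ (a ++ S ∷ []) ++ catS Bs
compX-shape m k As a Bs = begin
  p ++ catS (take (length As) ds) ++ n ++ joinS (drop (length As) ds)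
    ≡⟨ cong₂ (λ t d → p ++ catS t ++ n ++ joinS d) (take-length-++ As _) (drop-length-++ As _) ⟩
  p ++ catS As ++ n ++ joinS (a ∷ Bs ++ [] ∷ [])
    ≡⟨ cong (λ d → p ++ catS As ++ n ++ d) (joinS-∷-++[] a Bs) ⟩
  p ++ catS As ++ n ++ a ++ S ∷ catS Bs
    ≡⟨ solve 6 (λ p c n a s b → p ⊕ (c ⊕ (n ⊕ (a ⊕ (s ⊕ b)))) ⊜ (p ⊕ c) ⊕ (n ⊕ ((a ⊕ s) ⊕ b))) refl p (catS As) n a (S ∷ []) (catS Bs) ⟩
  (p ++ catS As) ++ n ++ (a ++ S ∷ []) ++ catS Bs ∎
  where
  open ≡-Reasoning
  p = N^ (m ∸ 1)
  n = N^ (k * (m ∸ 1))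
  ds = As ++ a ∷ Bs ++ [] ∷ []

AllDyck-++ : ∀ {m} xs ys → AllDyck m xs → AllDyck m ys → AllDyck m (xs ++ ys)
AllDyck-++ []       ys _        dys = dys
AllDyck-++ (x ∷ xs) ys (dx , dxs) dys = dx , AllDyck-++ xs ys dxs dys

block-index< : ∀ {m k j n} → 1 ≤ j → j ≤ m ∸ 1 → n ≡ m + k * (m ∸ 1) → j < n
block-index< {zero}  1≤j j≤0 _   = contradiction (≤-trans 1≤j j≤0) λ ()
block-index< {suc m} {k} _   j≤m len = ≤-trans (s≤s j≤m) (≤-trans (m≤m+n (suc m) (k * m)) (≤-reflexive (sym len)))

module _ {ℓ} {A : Set ℓ} {m k : ℕ} (F : Word → A)
         (F-deleteBlock : ∀ x y → F (x ++ N^ (k * (m ∸ 1)) ++ y) ≡ F (x ++ y)) where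

  RightComp-invariant : ∀ {w w′} → RightComp m k w w′ → F w ≡ F w′
  RightComp-invariant (rcomp u v j ds 1≤j j≤ len _) =
    trans (deleteBlock (j ∸ 1) (≤-trans (s≤s (m∸n≤m j 1)) j<)) (sym (deleteBlock j j<))
    where
    j< = block-index< {m} {k} 1≤j j≤ len
    deleteBlock : ∀ i → i < length ds →
      F (u ++ (N^ (m ∸ 1) ++ catS (take i ds) ++ N^ (k * (m ∸ 1)) ++ joinS (drop i ds)) ++ v)
      ≡ F (u ++ (N^ (m ∸ 1) ++ joinS ds) ++ v)
    deleteBlock i i< = begin
      F (u ++ (p ++ q ++ n ++ z) ++ v) ≡⟨ cong F (solve 6 (λ u p q n z v → u ⊕ ((p ⊕ (q ⊕ (n ⊕ z))) ⊕ v) ⊜ (u ⊕ (p ⊕ q)) ⊕ (n ⊕ (z ⊕ v))) refl u p q n z v) ⟩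
      F ((u ++ p ++ q) ++ n ++ z ++ v) ≡⟨ F-deleteBlock (u ++ p ++ q) (z ++ v) ⟩
      F ((u ++ p ++ q) ++ z ++ v)      ≡⟨ cong F (solve 5 (λ u p q z v → (u ⊕ (p ⊕ q)) ⊕ (z ⊕ v) ⊜ u ⊕ ((p ⊕ (q ⊕ z)) ⊕ v)) refl u p q z v) ⟩
      F (u ++ (p ++ q ++ z) ++ v)      ≡⟨ cong (λ t → F (u ++ (p ++ t) ++ v)) (catS-take++joinS-drop i ds i<) ⟩
      F (u ++ (p ++ joinS ds) ++ v)    ∎
      where
      open ≡-Reasoning
      p = N^ (m ∸ 1)
      q = catS (take i ds)
      n = N^ (k * (m ∸ 1))
      z = joinS (drop i ds)

  KEquiv-invariant : ∀ {w w′} → KEquiv m k w w′ → F w ≡ F w′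
  KEquiv-invariant = gfold (isEquivalence {A = A}) F RightComp-invariant

countS-deleteN^ : ∀ K x y → countS (x ++ N^ K ++ y) ≡ countS (x ++ y)
countS-deleteN^ K x y = begin
  countS (x ++ N^ K ++ y)        ≡⟨ countS-++ x _ ⟩
  countS x + countS (N^ K ++ y)  ≡⟨ cong (countS x +_) (countS-N^-++ K y) ⟩
  countS x + countS y            ≡⟨ countS-++ x y ⟨
  countS (x ++ y)                ∎
  where open ≡-Reasoning

RightComp-countS : ∀ {m k w w′} → RightComp m k w w′ → countS w ≡ countS w′
RightComp-countS {m} {k} = RightComp-invariant countS (countS-deleteN^ (k * (m ∸ 1)))

HasSN^ : ℕ → Word → Set
HasSN^ K = Infix _≡_ (S ∷ N^ K)

HasSN^-intro : ∀ K a b → HasSN^ K (a ++ S ∷ N^ K ++ b)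
HasSN^-intro K a b = fromView (MkView a (≡⇒Pointwise-≡ refl) b)

HasSN^-view : ∀ {K w} → HasSN^ K w → ∃₂ λ a b → w ≡ a ++ S ∷ N^ K ++ b
HasSN^-view h with MkView a S∷N^K≋ b ← toView h = a , b , cong (λ t → a ++ t ++ b) (sym (Pointwise-≡⇒≡ S∷N^K≋))

_≟_ : DecidableEquality Step
N ≟ N = yes refl
N ≟ S = no λ ()
S ≟ N = no λ ()
S ≟ S = yes refl

hasSN^? : ∀ K w → Dec (HasSN^ K w)
hasSN^? K = infix? _≟_ (S ∷ N^ K)

RightComp⇒HasSN^ : ∀ {m k w w′} → RightComp m k w w′ → HasSN^ (k * (m ∸ 1)) w′
RightComp⇒HasSN^ {m} {k} (rcomp u v j [] 1≤j j≤ len _) = contradiction (block-index< {m} {k} 1≤j j≤ len) λ ()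
RightComp⇒HasSN^ {m} {k} (rcomp u v (suc j) (d ∷ ds) _ _ _ _) =
  let A , eq = catS-∷-endsInS d (take j ds) in
  subst (HasSN^ (k * (m ∸ 1))) (sym (reshape A eq)) (HasSN^-intro _ (u ++ p ++ A) (z ++ v))
  where
  p = N^ (m ∸ 1)
  n = N^ (k * (m ∸ 1))
  z = joinS (drop j ds)
  reshape : ∀ {c} A → c ≡ A ++ S ∷ [] → u ++ (p ++ c ++ n ++ z) ++ v ≡ (u ++ p ++ A) ++ S ∷ n ++ z ++ v
  reshape A refl = solve 7 (λ u p a s n z v → u ⊕ ((p ⊕ ((a ⊕ s) ⊕ (n ⊕ z))) ⊕ v) ⊜ (u ⊕ (p ⊕ a)) ⊕ (s ⊕ (n ⊕ (z ⊕ v))))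
                     refl u p A (S ∷ []) n z v

Star-noPredecessor⇒≡ : ∀ {A : Set} {R : A → A → Set} {x y} → (∀ {z} → ¬ R z y) → Star R x y → x ≡ y
Star-noPredecessor⇒≡ noPred ε = refl
Star-noPredecessor⇒≡ noPred (r ◅ rs) with refl ← Star-noPredecessor⇒≡ noPred rs = contradiction r noPred

¬HasSN^⇒KMinimal : ∀ {m k Q} → ¬ HasSN^ (k * (m ∸ 1)) Q → KMinimal m k Q
¬HasSN^⇒KMinimal ¬h _ _ _ = Star-noPredecessor⇒≡ (λ rc → ¬h (RightComp⇒HasSN^ rc))

data Blocks : Word → Set where
  []  : Blocks []
  _∷_ : ∀ a {t} → Blocks t → Blocks (N^ a ++ S ∷ t)

Blocks-N∷ : ∀ {t} → Blocks t → t ≢ [] → Blocks (N ∷ t)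
Blocks-N∷ []       t≢[] = contradiction refl t≢[]
Blocks-N∷ (a ∷ bs) _    = suc a ∷ bs

Blocks-endsInS : ∀ v → Blocks (v ++ S ∷ [])
Blocks-endsInS []      = 0 ∷ []
Blocks-endsInS (S ∷ v) = 0 ∷ Blocks-endsInS v
Blocks-endsInS (N ∷ v) = Blocks-N∷ (Blocks-endsInS v) (λ eq → case ++-conicalʳ v _ eq of λ ())

¬HasSN^-after-S : ∀ {K} a t → ¬ HasSN^ K (S ∷ N^ a ++ t) → a < K
¬HasSN^-after-S {K} a t ¬h with a <? K
... | yes a<K = a<K
... | no  a≮K = contradiction (subst (HasSN^ K) (cong (S ∷_) (sym split)) (HasSN^-intro K [] (N^ (a ∸ K) ++ t))) ¬h
  where
  K≤a = ≮⇒≥ a≮K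
  split : N^ a ++ t ≡ N^ K ++ N^ (a ∸ K) ++ t
  split = begin
    N^ a ++ t                  ≡⟨ cong (λ b → N^ b ++ t) (m+[n∸m]≡n K≤a) ⟨
    N^ (K + (a ∸ K)) ++ t      ≡⟨ cong (_++ t) (N^-+ K (a ∸ K)) ⟩
    (N^ K ++ N^ (a ∸ K)) ++ t  ≡⟨ ++-assoc (N^ K) _ t ⟩
    N^ K ++ N^ (a ∸ K) ++ t    ∎
    where open ≡-Reasoning

Balanced : Word → Set
Balanced w = countN w ≡ countS w

Balanced-firstBlock-unique : ∀ a₁ a₂ t → Balanced (N^ a₁ ++ S ∷ t) → Balanced (N^ a₂ ++ S ∷ t) → a₁ ≡ a₂
Balanced-firstBlock-unique a₁ a₂ t bal₁ bal₂ = +-cancelʳ-≡ (countN t) a₁ a₂ (begin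
  a₁ + countN t             ≡⟨ countN-N^-++ a₁ (S ∷ t) ⟨
  countN (N^ a₁ ++ S ∷ t)  ≡⟨ bal₁ ⟩
  countS (N^ a₁ ++ S ∷ t)  ≡⟨ countS-N^-++ a₁ (S ∷ t) ⟩
  suc (countS t)            ≡⟨ countS-N^-++ a₂ (S ∷ t) ⟨
  countS (N^ a₂ ++ S ∷ t)  ≡⟨ bal₂ ⟨
  countN (N^ a₂ ++ S ∷ t)  ≡⟨ countN-N^-++ a₂ (S ∷ t) ⟩
  a₂ + countN t             ∎)
  where open ≡-Reasoning

module Residues (K : ℕ) .{{_ : NonZero K}} where

  residues : ℕ → Word → List ℕ
  residues c []      = []
  residues c (N ∷ w) = residues (suc c) w
  residues c (S ∷ w) = c % K ∷ residues c w

  residues-++ : ∀ c x y → residues c (x ++ y) ≡ residues c x ++ residues (c + countN x) y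
  residues-++ c []      y = cong (λ d → residues d y) (sym (+-identityʳ c))
  residues-++ c (N ∷ x) y = trans (residues-++ (suc c) x y) (cong (λ d → residues (suc c) x ++ residues d y) (sym (+-suc c (countN x))))
  residues-++ c (S ∷ x) y = cong (c % K ∷_) (residues-++ c x y)

  residues-N^ : ∀ c a y → residues c (N^ a ++ y) ≡ residues (c + a) y
  residues-N^ c zero    y = cong (λ d → residues d y) (sym (+-identityʳ c))
  residues-N^ c (suc a) y = trans (residues-N^ (suc c) a y) (cong (λ d → residues d y) (sym (+-suc c a)))

  residues-+K : ∀ c y → residues (c + K) y ≡ residues c y
  residues-+K c []      = refl
  residues-+K c (N ∷ y) = residues-+K (suc c) y
  residues-+K c (S ∷ y) = cong₂ _∷_ ([m+n]%n≡m%n c K) (residues-+K c y)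

  residues-deleteN^K : ∀ x y → residues 0 (x ++ N^ K ++ y) ≡ residues 0 (x ++ y)
  residues-deleteN^K x y = begin
    residues 0 (x ++ N^ K ++ y)                     ≡⟨ residues-++ 0 x (N^ K ++ y) ⟩
    residues 0 x ++ residues (countN x) (N^ K ++ y) ≡⟨ cong (residues 0 x ++_) (residues-N^ (countN x) K y) ⟩
    residues 0 x ++ residues (countN x + K) y       ≡⟨ cong (residues 0 x ++_) (residues-+K (countN x) y) ⟩
    residues 0 x ++ residues (countN x) y           ≡⟨ residues-++ 0 x y ⟨
    residues 0 (x ++ y)                             ∎
    where open ≡-Reasoning

  +-%-congʳ : ∀ {c₁ c₂} a → c₁ % K ≡ c₂ % K → (c₁ + a) % K ≡ (c₂ + a) % K
  +-%-congʳ {c₁} {c₂} a eq =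
    trans (%-distribˡ-+ c₁ a K) (trans (cong (λ x → (x + a % K) % K) eq) (sym (%-distribˡ-+ c₂ a K)))

  +-%-cancelˡ : ∀ c a b → (c + a) % K ≡ (c + b) % K → a % K ≡ b % K
  +-%-cancelˡ c a b eq = trans (undo a) (trans (cong (λ x → (x + c * pred K % K) % K) eq) (sym (undo b)))
    where
    undo : ∀ x → x % K ≡ ((c + x) % K + c * pred K % K) % K
    undo x = begin
      x % K                                ≡⟨ [m+kn]%n≡m%n x c K ⟨
      (x + c * K) % K                      ≡⟨ cong (λ k → (x + c * k) % K) (suc-pred K) ⟨
      (x + c * suc (pred K)) % K           ≡⟨ cong (_% K) (rearrange x c (pred K)) ⟩
      (c + x + c * pred K) % K             ≡⟨ %-distribˡ-+ (c + x) (c * pred K) K ⟩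
      ((c + x) % K + c * pred K % K) % K   ∎
      where
      open ≡-Reasoning
      rearrange : ∀ x c p → x + c * suc p ≡ c + x + c * p
      rearrange = solve-∀

  %-injective-< : ∀ {c₁ c₂ a₁ a₂} → c₁ % K ≡ c₂ % K → (c₁ + a₁) % K ≡ (c₂ + a₂) % K → a₁ < K → a₂ < K → a₁ ≡ a₂
  %-injective-< {c₁} {a₁ = a₁} {a₂} c≡ e a₁<K a₂<K = begin
    a₁     ≡⟨ m<n⇒m%n≡m a₁<K ⟨
    a₁ % K ≡⟨ +-%-cancelˡ c₁ a₁ a₂ (trans e (sym (+-%-congʳ a₂ c≡))) ⟩
    a₂ % K ≡⟨ m<n⇒m%n≡m a₂<K ⟩
    a₂     ∎
    where open ≡-Reasoning

  residues-block : ∀ c a t → residues c (N^ a ++ S ∷ t) ≡ (c + a) % K ∷ residues (c + a) t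
  residues-block c a t = residues-N^ c a (S ∷ t)

  Blocks-residues-injective : ∀ {t₁ t₂} c₁ c₂ → Blocks t₁ → Blocks t₂ →
    ¬ HasSN^ K (S ∷ t₁) → ¬ HasSN^ K (S ∷ t₂) →
    c₁ % K ≡ c₂ % K → residues c₁ t₁ ≡ residues c₂ t₂ → t₁ ≡ t₂
  Blocks-residues-injective c₁ c₂ []      []      _ _ _ _  = refl
  Blocks-residues-injective c₁ c₂ []      (a ∷ _) _ _ _ eq = case trans eq (residues-block c₂ a _) of λ ()
  Blocks-residues-injective c₁ c₂ (a ∷ _) []      _ _ _ eq = case trans (sym eq) (residues-block c₁ a _) of λ ()
  Blocks-residues-injective c₁ c₂ (a₁ ∷ bs₁) (a₂ ∷ bs₂) ¬h₁ ¬h₂ c≡ eq =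
    cong₂ (λ a t → N^ a ++ S ∷ t)
      (%-injective-< c≡ (∷-injectiveˡ eq′) (¬HasSN^-after-S a₁ _ ¬h₁) (¬HasSN^-after-S a₂ _ ¬h₂))
      (Blocks-residues-injective (c₁ + a₁) (c₂ + a₂) bs₁ bs₂
        (λ h → ¬h₁ ((S ∷ N^ a₁) ++ⁱ h)) (λ h → ¬h₂ ((S ∷ N^ a₂) ++ⁱ h)) (∷-injectiveˡ eq′) (∷-injectiveʳ eq′))
    where eq′ = trans (sym (residues-block c₁ a₁ _)) (trans eq (residues-block c₂ a₂ _))

  residues-injective : ∀ {R₁ R₂} → Blocks R₁ → Blocks R₂ → Balanced R₁ → Balanced R₂ →
    ¬ HasSN^ K R₁ → ¬ HasSN^ K R₂ → residues 0 R₁ ≡ residues 0 R₂ → R₁ ≡ R₂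
  residues-injective []      []      _ _ _ _ _  = refl
  residues-injective []      (a ∷ _) _ _ _ _ eq = case trans eq (residues-block 0 a _) of λ ()
  residues-injective (a ∷ _) []      _ _ _ _ eq = case trans (sym eq) (residues-block 0 a _) of λ ()
  residues-injective (a₁ ∷ bs₁) (a₂ ∷ bs₂) bal₁ bal₂ ¬h₁ ¬h₂ eq =
    trans (cong (λ t → N^ a₁ ++ S ∷ t) t₁≡t₂)
          (cong (λ a → N^ a ++ S ∷ _) (Balanced-firstBlock-unique a₁ a₂ _ (subst (λ t → Balanced (N^ a₁ ++ S ∷ t)) t₁≡t₂ bal₁) bal₂))
    where
    eq′ = trans (sym (residues-block 0 a₁ _)) (trans eq (residues-block 0 a₂ _))
    t₁≡t₂ = Blocks-residues-injective a₁ a₂ bs₁ bs₂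
              (λ h → ¬h₁ (N^ a₁ ++ⁱ h)) (λ h → ¬h₂ (N^ a₂ ++ⁱ h)) (∷-injectiveˡ eq′) (∷-injectiveʳ eq′)

expand-++ : ∀ m xs ys → expand m (xs ++ ys) ≡ expand m xs ++ expand m ys
expand-++ m []       ys = refl
expand-++ m (U ∷ xs) ys = trans (cong (N^ (m ∸ 1) ++_) (expand-++ m xs ys)) (sym (++-assoc (N^ (m ∸ 1)) _ _))
expand-++ m (D ∷ xs) ys = cong (S ∷_) (expand-++ m xs ys)

Valid-balance : ∀ {m} h bs → Valid m h bs → h + countN (expand m bs) ≡ countS (expand m bs)
Valid-balance h []             v = trans (+-identityʳ h) v
Valid-balance {m} h (U ∷ bs) v = begin
  h + countN (N^ (m ∸ 1) ++ e)   ≡⟨ cong (h +_) (countN-N^-++ (m ∸ 1) e) ⟩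
  h + ((m ∸ 1) + countN e)       ≡⟨ +-assoc h _ _ ⟨
  h + (m ∸ 1) + countN e         ≡⟨ Valid-balance (h + (m ∸ 1)) bs v ⟩
  countS e                       ≡⟨ countS-N^-++ (m ∸ 1) e ⟨
  countS (N^ (m ∸ 1) ++ e)       ∎
  where
  open ≡-Reasoning
  e = expand m bs
Valid-balance (suc h) (D ∷ bs) v = cong suc (Valid-balance h bs v)

IsDyck⇒Balanced : ∀ {m w} → IsDyck m w → Balanced w
IsDyck⇒Balanced (bs , v , refl) = Valid-balance 0 bs v

Valid-endsInS : ∀ {m} h bs → 1 ≤ m ∸ 1 → Valid m h bs → bs ≡ [] ⊎ ∃ λ v → expand m bs ≡ v ++ S ∷ []
Valid-endsInS h []           _  _ = inj₁ refl
Valid-endsInS {m} h (U ∷ []) 1≤r v = contradiction v (m<n⇒n≢0 (≤-trans 1≤r (m≤n+m (m ∸ 1) h)))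
Valid-endsInS {m} h (U ∷ b ∷ bs) 1≤r v with Valid-endsInS (h + (m ∸ 1)) (b ∷ bs) 1≤r v
... | inj₂ (w , eq) = inj₂ (N^ (m ∸ 1) ++ w , trans (cong (N^ (m ∸ 1) ++_) eq) (sym (++-assoc (N^ (m ∸ 1)) w _)))
Valid-endsInS (suc h) (D ∷ bs) 1≤r v with Valid-endsInS h bs 1≤r v
... | inj₁ refl       = inj₂ ([] , refl)
... | inj₂ (w , eq)    = inj₂ (S ∷ w , cong (S ∷_) eq)

IsDyck⇒Blocks : ∀ {m w} → 1 ≤ m ∸ 1 → IsDyck m w → Blocks w
IsDyck⇒Blocks 1≤r (bs , v , refl) with Valid-endsInS 0 bs 1≤r v
... | inj₁ refl     = []
... | inj₂ (w , eq) = subst Blocks (sym eq) (Blocks-endsInS w)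

areaFrom : ℕ → Word → ℕ
areaFrom c []      = 0
areaFrom c (N ∷ w) = areaFrom (suc c) w
areaFrom c (S ∷ w) = c + areaFrom c w

area : Word → ℕ
area = areaFrom 0

areaFrom-++ : ∀ c x y → areaFrom c (x ++ y) ≡ areaFrom c x + areaFrom (c + countN x) y
areaFrom-++ c []      y = cong (λ d → areaFrom d y) (sym (+-identityʳ c))
areaFrom-++ c (N ∷ x) y = trans (areaFrom-++ (suc c) x y) (cong (λ d → areaFrom (suc c) x + areaFrom d y) (sym (+-suc c (countN x))))
areaFrom-++ c (S ∷ x) y = trans (cong (c +_) (areaFrom-++ c x y)) (sym (+-assoc c _ _))

areaFrom-suc : ∀ c y → areaFrom (suc c) y ≡ areaFrom c y + countS y
areaFrom-suc c []      = refl
areaFrom-suc c (N ∷ y) = areaFrom-suc (suc c) y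
areaFrom-suc c (S ∷ y) = trans (cong (suc c +_) (areaFrom-suc c y)) (rearrange c (areaFrom c y) (countS y))
  where
  rearrange : ∀ c x s → suc c + (x + s) ≡ c + x + suc s
  rearrange = solve-∀

areaFrom-N^ : ∀ c a y → areaFrom c (N^ a ++ y) ≡ areaFrom c y + a * countS y
areaFrom-N^ c zero    y = sym (+-identityʳ (areaFrom c y))
areaFrom-N^ c (suc a) y = begin
  areaFrom (suc c) (N^ a ++ y)                  ≡⟨ areaFrom-N^ (suc c) a y ⟩
  areaFrom (suc c) y + a * countS y             ≡⟨ cong (_+ a * countS y) (areaFrom-suc c y) ⟩
  areaFrom c y + countS y + a * countS y        ≡⟨ +-assoc (areaFrom c y) _ _ ⟩
  areaFrom c y + suc a * countS y               ∎
  where open ≡-Reasoning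

areaFrom-swapN^ : ∀ c K B y → areaFrom c (N^ K ++ B ++ y) ≡ areaFrom c (B ++ N^ K ++ y) + K * countS B
areaFrom-swapN^ c K B y = begin
  areaFrom c (N^ K ++ B ++ y)                                       ≡⟨ areaFrom-N^ c K (B ++ y) ⟩
  areaFrom c (B ++ y) + K * countS (B ++ y)                         ≡⟨ cong₂ (λ a s → a + K * s) (areaFrom-++ c B y) (countS-++ B y) ⟩
  areaFrom c B + areaFrom c′ y + K * (countS B + countS y)          ≡⟨ rearrange (areaFrom c B) (areaFrom c′ y) K (countS B) (countS y) ⟩
  areaFrom c B + (areaFrom c′ y + K * countS y) + K * countS B      ≡⟨ cong (λ a → areaFrom c B + a + K * countS B) (areaFrom-N^ c′ K y) ⟨
  areaFrom c B + areaFrom c′ (N^ K ++ y) + K * countS B             ≡⟨ cong (_+ K * countS B) (areaFrom-++ c B (N^ K ++ y)) ⟨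
  areaFrom c (B ++ N^ K ++ y) + K * countS B                        ∎
  where
  open ≡-Reasoning
  c′ = c + countN B
  rearrange : ∀ b x K s t → b + x + K * (s + t) ≡ b + (x + K * t) + K * s
  rearrange = solve-∀

area-moveN^-left : ∀ x K B y → 0 < K → 0 < countS B → area (x ++ B ++ N^ K ++ y) < area (x ++ N^ K ++ B ++ y)
area-moveN^-left x K B y 0<K 0<sB = begin-strict
  area (x ++ B ++ N^ K ++ y)                                            ≡⟨ areaFrom-++ 0 x _ ⟩
  area x + areaFrom (countN x) (B ++ N^ K ++ y)                         <⟨ +-monoʳ-< (area x) (m<m+n _ (*-mono-< 0<K 0<sB)) ⟩
  area x + (areaFrom (countN x) (B ++ N^ K ++ y) + K * countS B)        ≡⟨ cong (area x +_) (areaFrom-swapN^ (countN x) K B y) ⟨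
  area x + areaFrom (countN x) (N^ K ++ B ++ y)                         ≡⟨ areaFrom-++ 0 x _ ⟨
  area (x ++ N^ K ++ B ++ y)                                            ∎
  where open ≤-Reasoning

areaFrom-bound : ∀ c w → areaFrom c w ≤ (c + countN w) * countS w
areaFrom-bound c []      = z≤n
areaFrom-bound c (N ∷ w) = subst (λ d → areaFrom (suc c) w ≤ d * countS w) (sym (+-suc c (countN w))) (areaFrom-bound (suc c) w)
areaFrom-bound c (S ∷ w) = subst (c + areaFrom c w ≤_) (sym (*-suc (c + countN w) (countS w)))
                             (+-mono-≤ (m≤m+n c (countN w)) (areaFrom-bound c w))

IsDyck-area-bound : ∀ {m w} → IsDyck m w → area w ≤ countS w * countS w
IsDyck-area-bound {w = w} d = subst (λ n → area w ≤ n * countS w) (IsDyck⇒Balanced d) (areaFrom-bound 0 w)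

U^ : ℕ → List BigStep
U^ t = replicate t U

module Paths (m : ℕ) where

  r : ℕ
  r = m ∸ 1

  ValidTo : ℕ → List BigStep → ℕ → Set
  ValidTo h       []       x = h ≡ x
  ValidTo h       (U ∷ bs) x = ValidTo (h + r) bs x
  ValidTo zero    (D ∷ bs) x = ⊥
  ValidTo (suc h) (D ∷ bs) x = ValidTo h bs x

  Valid⇒ValidTo : ∀ h bs → Valid m h bs → ValidTo h bs 0
  Valid⇒ValidTo h       []       v = v
  Valid⇒ValidTo h       (U ∷ bs) v = Valid⇒ValidTo (h + r) bs v
  Valid⇒ValidTo (suc h) (D ∷ bs) v = Valid⇒ValidTo h bs v

  ValidTo⇒Valid : ∀ h bs → ValidTo h bs 0 → Valid m h bs
  ValidTo⇒Valid h       []       v = v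
  ValidTo⇒Valid h       (U ∷ bs) v = ValidTo⇒Valid (h + r) bs v
  ValidTo⇒Valid (suc h) (D ∷ bs) v = ValidTo⇒Valid h bs v

  ValidTo-++ : ∀ h xs {y ys x} → ValidTo h xs y → ValidTo y ys x → ValidTo h (xs ++ ys) x
  ValidTo-++ h       []       refl q = q
  ValidTo-++ h       (U ∷ xs) p    q = ValidTo-++ (h + r) xs p q
  ValidTo-++ (suc h) (D ∷ xs) p    q = ValidTo-++ h xs p q

  ValidTo-++⁻ : ∀ h xs {ys x} → ValidTo h (xs ++ ys) x → ∃ λ y → ValidTo h xs y × ValidTo y ys x
  ValidTo-++⁻ h       []       p = h , refl , p
  ValidTo-++⁻ h       (U ∷ xs) p = ValidTo-++⁻ (h + r) xs p
  ValidTo-++⁻ (suc h) (D ∷ xs) p = ValidTo-++⁻ h xs p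

  ValidTo-raise : ∀ d H E {ys x} → Valid m d E → ValidTo H ys x → ValidTo (d + H) (E ++ ys) x
  ValidTo-raise d       H []       refl p = p
  ValidTo-raise d       H (U ∷ E) {ys} {x} v p = subst (λ h → ValidTo h (E ++ ys) x) (xy∙z≈xz∙y d r H) (ValidTo-raise (d + r) H E v p)
  ValidTo-raise (suc d) H (D ∷ E)  v    p = ValidTo-raise d H E v p

  ValidTo-U^ : ∀ t h {ys x} → ValidTo (h + t * r) ys x → ValidTo h (U^ t ++ ys) x
  ValidTo-U^ zero    h {ys} {x} p = subst (λ h → ValidTo h ys x) (+-identityʳ h) p
  ValidTo-U^ (suc t) h {ys} {x} p = ValidTo-U^ t (h + r) (subst (λ h → ValidTo h ys x) (sym (+-assoc h r (t * r))) p)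

  ValidTo-U^⁻ : ∀ t h {ys x} → ValidTo h (U^ t ++ ys) x → ValidTo (h + t * r) ys x
  ValidTo-U^⁻ zero    h {ys} {x} p = subst (λ h → ValidTo h ys x) (sym (+-identityʳ h)) p
  ValidTo-U^⁻ (suc t) h {ys} {x} p = subst (λ h → ValidTo h ys x) (+-assoc h r (t * r)) (ValidTo-U^⁻ t (h + r) p)

  catD : List (List BigStep) → List BigStep → List BigStep
  catD []       ys = ys
  catD (E ∷ Es) ys = E ++ D ∷ catD Es ys

  ValidTo-catD : ∀ Es H ys {x} → All (Valid m 0) Es → ValidTo H ys x → ValidTo (length Es + H) (catD Es ys) x
  ValidTo-catD []       H ys _        p = p
  ValidTo-catD (E ∷ Es) H ys (v ∷ vs) p = ValidTo-raise 0 (suc (length Es + H)) E v (ValidTo-catD Es H ys vs p)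

  firstPassage : ∀ d H ys → Valid m (d + suc H) ys →
    ∃₂ λ E ys′ → ys ≡ E ++ D ∷ ys′ × Valid m d E × Valid m H ys′
  firstPassage d       H []       v = case trans (sym (+-suc d H)) v of λ ()
  firstPassage d       H (U ∷ ys) v with firstPassage (d + r) H ys (subst (λ h → Valid m h ys) (xy∙z≈xz∙y d (suc H) r) v)
  ... | E , ys′ , refl , vE , vys′ = U ∷ E , ys′ , refl , vE , vys′
  firstPassage zero    H (D ∷ ys) v = [] , ys , refl , refl , v
  firstPassage (suc d) H (D ∷ ys) v with firstPassage d H ys v
  ... | E , ys′ , refl , vE , vys′ = D ∷ E , ys′ , refl , vE , vys′

  firstPassages : ∀ q H ys → Valid m (q + H) ys →
    ∃₂ λ Es rest → length Es ≡ q × All (Valid m 0) Es × ys ≡ catD Es rest × Valid m H rest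
  firstPassages zero    H ys v = [] , ys , refl , [] , refl , v
  firstPassages (suc q) H ys v with firstPassage 0 (q + H) ys v
  ... | E , ys′ , refl , vE , vys′ with firstPassages q H ys′ vys′
  ...   | Es , rest , refl , vEs , refl , vrest = E ∷ Es , rest , refl , vE ∷ vEs , refl , vrest

  staysAbove⊎dips : ∀ d x p → ValidTo (d + x) p x →
    Valid m d p ⊎ ∃₂ λ A B → ∃ λ x′ → p ≡ A ++ D ∷ B × Valid m d A × x ≡ suc x′ × ValidTo x′ B x
  staysAbove⊎dips d    x       []      eq = inj₁ (+-cancelʳ-≡ x d 0 eq)
  staysAbove⊎dips d    x       (U ∷ p) v with staysAbove⊎dips (d + r) x p (subst (λ h → ValidTo h p x) (xy∙z≈xz∙y d x r) v)
  ... | inj₁ vp                                 = inj₁ vp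
  ... | inj₂ (A , B , x′ , refl , vA , eq , vB) = inj₂ (U ∷ A , B , x′ , refl , vA , eq , vB)
  staysAbove⊎dips zero    (suc x) (D ∷ p) v = inj₂ ([] , p , x , refl , refl , refl , v)
  staysAbove⊎dips (suc d) x       (D ∷ p) v with staysAbove⊎dips d x p v
  ... | inj₁ vp                                 = inj₁ vp
  ... | inj₂ (A , B , x′ , refl , vA , eq , vB) = inj₂ (D ∷ A , B , x′ , refl , vA , eq , vB)

  length-suffix : ∀ (A B : List BigStep) → length B ≤ length (A ++ D ∷ B)
  length-suffix A B = subst (length B ≤_) (sym (length-++ A)) (≤-trans (n≤1+n (length B)) (m≤n+m (suc (length B)) (length A)))

  -- The last up-step of p that reaches level x; relative to x, the rest Y is an excursion
  -- from its top y + r down to x.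
  lastCrossing : ∀ n p h₀ x → length p ≤ n → ValidTo h₀ p x → h₀ < x →
    ∃₂ λ u Y → ∃ λ y → p ≡ u ++ U ∷ Y × y < x × x ≤ y + r × ValidTo h₀ u y × Valid m (y + r ∸ x) Y
  lastCrossing n       []      h₀       x _ refl h₀<x = contradiction h₀<x (<-irrefl refl)
  lastCrossing (suc n) (D ∷ p) (suc h₀) x (s≤s l) v h₀<x with lastCrossing n p h₀ x l v (≤-trans (n≤1+n _) h₀<x)
  ... | u , Y , y , refl , y<x , x≤ , vu , vY = D ∷ u , Y , y , refl , y<x , x≤ , vu , vY
  lastCrossing (suc n) (U ∷ p) h₀       x (s≤s l) v h₀<x with h₀ + r <? x
  ... | yes h₀+r<x with lastCrossing n p (h₀ + r) x l v h₀+r<x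
  ...   | u , Y , y , refl , y<x , x≤ , vu , vY = U ∷ u , Y , y , refl , y<x , x≤ , vu , vY
  lastCrossing (suc n) (U ∷ p) h₀       x (s≤s l) v h₀<x | no h₀+r≮x
    with staysAbove⊎dips (h₀ + r ∸ x) x p (subst (λ h → ValidTo h p x) (sym (m∸n+n≡m (≮⇒≥ h₀+r≮x))) v)
  ... | inj₁ vp = [] , p , h₀ , refl , h₀<x , ≮⇒≥ h₀+r≮x , refl , vp
  ... | inj₂ (A , B , x′ , refl , vA , refl , vB) with lastCrossing n B x′ (suc x′) (≤-trans (length-suffix A B) l) vB ≤-refl
  ...   | u , Y , y , refl , y<x , x≤ , vu , vY =
          U ∷ A ++ D ∷ u , Y , y , cong (U ∷_) (sym (++-assoc A (D ∷ u) _)) , y<x , x≤ ,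
          subst (λ h → ValidTo h (A ++ D ∷ u) y) (m∸n+n≡m (≮⇒≥ h₀+r≮x)) (ValidTo-raise (h₀ + r ∸ suc x′) (suc x′) A vA vu) ,
          vY

  expand-U^ : ∀ t zs → expand m (U^ t ++ zs) ≡ N^ (t * r) ++ expand m zs
  expand-U^ zero    zs = refl
  expand-U^ (suc t) zs = begin
    N^ r ++ expand m (U^ t ++ zs)       ≡⟨ cong (N^ r ++_) (expand-U^ t zs) ⟩
    N^ r ++ N^ (t * r) ++ expand m zs   ≡⟨ ++-assoc (N^ r) _ _ ⟨
    (N^ r ++ N^ (t * r)) ++ expand m zs ≡⟨ cong (_++ expand m zs) (N^-+ r (t * r)) ⟨
    N^ (r + t * r) ++ expand m zs       ∎
    where open ≡-Reasoning

  expand-catD : ∀ Es zs → expand m (catD Es zs) ≡ catS (map (expand m) Es) ++ expand m zs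
  expand-catD []       zs = refl
  expand-catD (E ∷ Es) zs = begin
    expand m (E ++ D ∷ catD Es zs)                              ≡⟨ expand-++ m E _ ⟩
    expand m E ++ S ∷ expand m (catD Es zs)                     ≡⟨ cong (λ t → expand m E ++ S ∷ t) (expand-catD Es zs) ⟩
    expand m E ++ S ∷ catS (map (expand m) Es) ++ expand m zs   ≡⟨ solve 4 (λ e s c z → e ⊕ (s ⊕ (c ⊕ z)) ⊜ ((e ⊕ s) ⊕ c) ⊕ z) refl (expand m E) (S ∷ []) _ _ ⟩
    catS (map (expand m) (E ∷ Es)) ++ expand m zs               ∎
    where open ≡-Reasoning

  All-Valid⇒AllDyck : ∀ Es → All (Valid m 0) Es → AllDyck m (map (expand m) Es)
  All-Valid⇒AllDyck []       []       = tt
  All-Valid⇒AllDyck (E ∷ Es) (v ∷ vs) = (E , v , refl) , All-Valid⇒AllDyck Es vs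

N^-++-S : ∀ n e a c → N^ n ++ e ≡ a ++ S ∷ c → ∃ λ a′ → e ≡ a′ ++ S ∷ c
N^-++-S zero    e a       c eq = a , eq
N^-++-S (suc n) e (_ ∷ a) c eq = N^-++-S n e a c (∷-injectiveʳ eq)

expand-split-S : ∀ m bs a c → expand m bs ≡ a ++ S ∷ c → ∃₂ λ bs₁ bs₂ → bs ≡ bs₁ ++ D ∷ bs₂ × expand m bs₂ ≡ c
expand-split-S m (D ∷ bs) []      c eq = [] , bs , refl , ∷-injectiveʳ eq
expand-split-S m (D ∷ bs) (_ ∷ a) c eq with expand-split-S m bs a c (∷-injectiveʳ eq)
... | bs₁ , bs₂ , refl , eq₂ = D ∷ bs₁ , bs₂ , refl , eq₂
expand-split-S m (U ∷ bs) a       c eq with N^-++-S (m ∸ 1) (expand m bs) a c eq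
... | a′ , eq′ with expand-split-S m bs a′ c eq′
...   | bs₁ , bs₂ , refl , eq₂ = U ∷ bs₁ , bs₂ , refl , eq₂

expand-N^-prefix : ∀ m′ t bs b → expand (2 + m′) bs ≡ N^ (t * suc m′) ++ b → ∃ λ bs′ → bs ≡ U^ t ++ bs′
expand-N^-prefix m′ zero    bs       b eq = bs , refl
expand-N^-prefix m′ (suc t) (U ∷ bs) b eq with expand-N^-prefix m′ t bs b
    (++-cancelˡ (N^ (suc m′)) _ _ (trans eq (trans (cong (_++ b) (N^-+ (suc m′) (t * suc m′))) (++-assoc (N^ (suc m′)) _ b))))
... | bs′ , refl = bs′ , refl

++-inContext : ∀ (e p x y z v : Word) → e ++ (p ++ x ++ y ++ z) ++ v ≡ (e ++ p) ++ x ++ y ++ z ++ v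
++-inContext = solve 6 (λ e p x y z v → e ⊕ ((p ⊕ (x ⊕ (y ⊕ z))) ⊕ v) ⊜ (e ⊕ p) ⊕ (x ⊕ (y ⊕ (z ⊕ v)))) refl

module Decompression (m′ k′ : ℕ) where

  m k K : ℕ
  m = 2 + m′
  k = 1 + k′
  K = k * (m ∸ 1)

  open Paths m

  block-counts : ∀ {e f y h} → y ≤ h → e + suc h ≡ y + r → f + y ≡ h + K → e ≤ m′ × e + f ≡ m′ + K
  block-counts {e} {f} {y} {h} y≤h top bottom =
    +-cancelʳ-≤ (suc h) e m′ (begin
      e + suc h  ≡⟨ top ⟩
      y + r      ≤⟨ +-monoˡ-≤ r y≤h ⟩
      h + r      ≡⟨ swap h m′ ⟩
      m′ + suc h ∎) ,
    +-cancelʳ-≡ (suc h + y) (e + f) (m′ + K) (begin-equality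
      e + f + (suc h + y)       ≡⟨ interchange e f (suc h) y ⟩
      e + suc h + (f + y)       ≡⟨ cong₂ _+_ top bottom ⟩
      y + suc m′ + (h + K)      ≡⟨ collect y m′ h K ⟩
      m′ + K + (suc h + y)      ∎)
    where
    open ≤-Reasoning
    swap : ∀ h m′ → h + suc m′ ≡ m′ + suc h
    swap = solve-∀
    interchange : ∀ e f h y → e + f + (h + y) ≡ e + h + (f + y)
    interchange = solve-∀
    collect : ∀ y m′ h K → y + suc m′ + (h + K) ≡ m′ + K + (suc h + y)
    collect = solve-∀

  module Split (u : List BigStep) (Es : List (List BigStep)) (Ej : List BigStep) (Fs : List (List BigStep)) (rest : List BigStep) where

    compressed : List BigStep
    compressed = (u ++ U ∷ catD Es Ej) ++ D ∷ U^ k ++ catD Fs rest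

    decompressed : List BigStep
    decompressed = u ++ U ∷ catD Es (U^ k ++ Ej ++ D ∷ catD Fs rest)

    front middle back : Word
    front  = expand m u ++ N^ r ++ catS (map (expand m) Es)
    middle = expand m Ej ++ S ∷ []
    back   = catS (map (expand m) Fs) ++ expand m rest

    -- The paper's D₁ … D_{m+k(m−1)}: Es, then D_j = Ej, then Fs, and an empty last one.
    ds : List Word
    ds = map (expand m) Es ++ expand m Ej ∷ map (expand m) Fs ++ [] ∷ []

    expand-compressed : expand m compressed ≡ front ++ middle ++ N^ K ++ back
    expand-compressed = begin
      expand m ((u ++ U ∷ catD Es Ej) ++ D ∷ U^ k ++ catD Fs rest)
        ≡⟨ expand-++ m (u ++ U ∷ catD Es Ej) _ ⟩
      expand m (u ++ U ∷ catD Es Ej) ++ S ∷ expand m (U^ k ++ catD Fs rest)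
        ≡⟨ cong₂ (λ x z → x ++ S ∷ z) (expand-++ m u (U ∷ catD Es Ej)) (expand-U^ k (catD Fs rest)) ⟩
      (eu ++ N^ r ++ expand m (catD Es Ej)) ++ S ∷ N^ K ++ expand m (catD Fs rest)
        ≡⟨ cong₂ (λ x z → (eu ++ N^ r ++ x) ++ S ∷ N^ K ++ z) (expand-catD Es Ej) (expand-catD Fs rest) ⟩
      (eu ++ N^ r ++ catS As ++ a) ++ S ∷ N^ K ++ catS Bs ++ ev
        ≡⟨ solve 8 (λ eu p c a s n b v → (eu ⊕ (p ⊕ (c ⊕ a))) ⊕ (s ⊕ (n ⊕ (b ⊕ v))) ⊜ (eu ⊕ (p ⊕ c)) ⊕ ((a ⊕ s) ⊕ (n ⊕ (b ⊕ v))))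
             refl eu (N^ r) (catS As) a (S ∷ []) (N^ K) (catS Bs) ev ⟩
      front ++ middle ++ N^ K ++ back ∎
      where
      open ≡-Reasoning
      eu = expand m u
      ev = expand m rest
      As = map (expand m) Es
      a  = expand m Ej
      Bs = map (expand m) Fs

    expand-decompressed : expand m decompressed ≡ front ++ N^ K ++ middle ++ back
    expand-decompressed = begin
      expand m (u ++ U ∷ catD Es (U^ k ++ Ej ++ D ∷ catD Fs rest))
        ≡⟨ expand-++ m u _ ⟩
      eu ++ N^ r ++ expand m (catD Es (U^ k ++ Ej ++ D ∷ catD Fs rest))
        ≡⟨ cong (λ x → eu ++ N^ r ++ x) (expand-catD Es _) ⟩
      eu ++ N^ r ++ catS As ++ expand m (U^ k ++ Ej ++ D ∷ catD Fs rest)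
        ≡⟨ cong (λ x → eu ++ N^ r ++ catS As ++ x) (expand-U^ k _) ⟩
      eu ++ N^ r ++ catS As ++ N^ K ++ expand m (Ej ++ D ∷ catD Fs rest)
        ≡⟨ cong (λ x → eu ++ N^ r ++ catS As ++ N^ K ++ x) (expand-++ m Ej _) ⟩
      eu ++ N^ r ++ catS As ++ N^ K ++ a ++ S ∷ expand m (catD Fs rest)
        ≡⟨ cong (λ x → eu ++ N^ r ++ catS As ++ N^ K ++ a ++ S ∷ x) (expand-catD Fs rest) ⟩
      eu ++ N^ r ++ catS As ++ N^ K ++ a ++ S ∷ catS Bs ++ ev
        ≡⟨ solve 8 (λ eu p c n a s b v → eu ⊕ (p ⊕ (c ⊕ (n ⊕ (a ⊕ (s ⊕ (b ⊕ v)))))) ⊜ (eu ⊕ (p ⊕ c)) ⊕ (n ⊕ ((a ⊕ s) ⊕ (b ⊕ v))))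
             refl eu (N^ r) (catS As) (N^ K) a (S ∷ []) (catS Bs) ev ⟩
      front ++ N^ K ++ middle ++ back ∎
      where
      open ≡-Reasoning
      eu = expand m u
      ev = expand m rest
      As = map (expand m) Es
      a  = expand m Ej
      Bs = map (expand m) Fs

    Valid-decompressed : ∀ {y h} → ValidTo 0 u y → All (Valid m 0) Es → Valid m 0 Ej → All (Valid m 0) Fs →
      Valid m y rest → length Es + suc h ≡ y + r → length Fs + y ≡ h + K → Valid m 0 decompressed
    Valid-decompressed {y} {h} vu vEs vEj vFs vrest top bottom =
      ValidTo⇒Valid 0 decompressed (ValidTo-++ 0 u vu
        (subst (λ h′ → ValidTo h′ (catD Es (U^ k ++ Ej ++ D ∷ catD Fs rest)) 0) top
          (ValidTo-catD Es (suc h) (U^ k ++ Ej ++ D ∷ catD Fs rest) vEs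
            (ValidTo-U^ k (suc h) {Ej ++ D ∷ catD Fs rest}
              (ValidTo-raise 0 (suc (h + K)) Ej {D ∷ catD Fs rest} vEj
                (subst (λ h′ → ValidTo h′ (catD Fs rest) 0) bottom
                  (ValidTo-catD Fs y rest vFs (Valid⇒ValidTo y rest vrest))))))))

    RightComp-decompressed : length Es ≤ m′ → length Es + length Fs ≡ m′ + K →
      All (Valid m 0) Es → Valid m 0 Ej → All (Valid m 0) Fs →
      RightComp m k (expand m decompressed) (expand m compressed)
    RightComp-decompressed e≤m′ e+f vEs vEj vFs =
      subst₂ (RightComp m k)
        (trans (cong (λ x → expand m u ++ x ++ expand m rest) (compX-shape m k As (expand m Ej) Bs))
          (trans (++-inContext (expand m u) (N^ r ++ catS As) (N^ K) middle (catS Bs) (expand m rest)) (sym expand-decompressed)))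
        (trans (cong (λ x → expand m u ++ x ++ expand m rest) (compX'-shape m k As (expand m Ej) Bs))
          (trans (++-inContext (expand m u) (N^ r ++ catS As) middle (N^ K) (catS Bs) (expand m rest)) (sym expand-compressed)))
        (rcomp (expand m u) (expand m rest) (suc (length As)) ds z<s
           (s≤s (subst (_≤ m′) (sym (length-map (expand m) Es)) e≤m′)) length-ds
           (AllDyck-++ As _ (All-Valid⇒AllDyck Es vEs)
             ((Ej , vEj , refl) , AllDyck-++ Bs _ (All-Valid⇒AllDyck Fs vFs) (([] , refl , refl) , tt))))
      where
      As = map (expand m) Es
      Bs = map (expand m) Fs
      length-ds : length ds ≡ m + K
      length-ds = begin
        length (As ++ expand m Ej ∷ Bs ++ [] ∷ [])          ≡⟨ length-++ As ⟩
        length As + suc (length (Bs ++ [] ∷ []))             ≡⟨ cong₂ (λ p q → p + suc q) (length-map (expand m) Es) (trans (length-++ Bs) (cong (_+ 1) (length-map (expand m) Fs))) ⟩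
        length Es + suc (length Fs + 1)                      ≡⟨ rearrange (length Es) (length Fs) ⟩
        suc (suc (length Es + length Fs))                    ≡⟨ cong (λ n → suc (suc n)) e+f ⟩
        m + K                                                ∎
        where
        open ≡-Reasoning
        rearrange : ∀ e f → e + suc (f + 1) ≡ suc (suc (e + f))
        rearrange = solve-∀

    area-decompressed : area (expand m compressed) < area (expand m decompressed)
    area-decompressed = subst₂ _<_ (sym (cong area expand-compressed)) (sym (cong area expand-decompressed))
      (area-moveN^-left front K middle back z<s (0<countS-++S (expand m Ej)))

  y≤h+K : ∀ {y h} → y < suc h → y ≤ h + K
  y≤h+K y<1+h = ≤-trans (≤-pred y<1+h) (m≤m+n _ K)

  decompress : ∀ w → IsDyck m w → HasSN^ K w → ∃ λ w′ → IsDyck m w′ × RightComp m k w′ w × area w < area w′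
  decompress w (bs , v , refl) hasSN^ with HasSN^-view hasSN^
  ... | a , b , eq with expand-split-S m bs a _ eq
  ... | bs₁ , bs₂ , refl , eq₂ with expand-N^-prefix m′ k bs₂ b eq₂
  ... | bs₃ , refl with ValidTo-++⁻ 0 bs₁ {D ∷ U^ k ++ bs₃} {0} (Valid⇒ValidTo 0 (bs₁ ++ D ∷ U^ k ++ bs₃) v)
  ... | zero  , _  , ()
  ... | suc h , v₁ , v₂ with lastCrossing (length bs₁) bs₁ 0 (suc h) ≤-refl v₁ z<s
  ... | u , Y , y , refl , y<1+h , 1+h≤y+r , vu , vY
      with firstPassages (y + r ∸ suc h) 0 Y (subst (λ h′ → Valid m h′ Y) (sym (+-identityʳ _)) vY)
  ... | Es , Ej , lenEs , vEs , refl , vEj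
      with firstPassages (h + K ∸ y) y bs₃
             (ValidTo⇒Valid _ bs₃ (subst (λ h′ → ValidTo h′ bs₃ 0) (sym (m∸n+n≡m (y≤h+K y<1+h))) (ValidTo-U^⁻ k h {bs₃} {0} v₂)))
  ... | Fs , rest , lenFs , vFs , refl , vrest =
    let open Split u Es Ej Fs rest
        top    = trans (cong (_+ suc h) lenEs) (m∸n+n≡m 1+h≤y+r)
        bottom = trans (cong (_+ y) lenFs) (m∸n+n≡m (y≤h+K y<1+h))
        e≤m′ , e+f = block-counts (≤-pred y<1+h) top bottom
    in expand m decompressed , (decompressed , Valid-decompressed vu vEs vEj vFs vrest top bottom , refl) ,
       RightComp-decompressed e≤m′ e+f vEs vEj vFs , area-decompressed

  -- Decompressing raises the area, which stays ≤ n * n, so the fuel never runs out.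
  reachMinimal : ∀ n fuel w → IsDyck m w → countS w ≡ n → n * n ≤ fuel + area w →
    ∃ λ Q → IsDyck m Q × countS Q ≡ n × KEquiv m k w Q × ¬ HasSN^ K Q
  reachMinimal n fuel w d len bound with hasSN^? K w
  ... | no ¬h = w , d , len , ε , ¬h
  ... | yes h with decompress w d h
  ...   | w′ , d′ , w′→w , grows with fuel
  ...     | zero = contradiction bound (<⇒≱ (<-≤-trans grows
                 (subst (λ c → area w′ ≤ c * c) (trans (RightComp-countS w′→w) len) (IsDyck-area-bound d′))))
  ...     | suc fuel′ =
    let Q , dQ , lenQ , w′~Q , ¬hQ = reachMinimal n fuel′ w′ d′ (trans (RightComp-countS w′→w) len)
                                       (≤-trans bound (+-monoʳ-< fuel′ grows))
    in Q , dQ , lenQ , bwd w′→w ◅ w′~Q , ¬hQ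

  KMinimal⇒¬HasSN^ : ∀ {R} → IsDyck m R → KMinimal m k R → ¬ HasSN^ K R
  KMinimal⇒¬HasSN^ {R} d minimal h with decompress R d h
  ... | w′ , d′ , w′→R , grows with refl ← minimal w′ d′ (RightComp-countS w′→R) (w′→R ◅ ε) = <-irrefl refl grows

proposition3p14 : (m k g : ℕ) → 2 ≤ m → 1 ≤ k →
    (P : Word) → IsDyck m P → countS P ≡ (m + g * (m ∸ 1)) ∸ 1 →
    Σ Word (λ Q → (IsDyck m Q × countS Q ≡ (m + g * (m ∸ 1)) ∸ 1 × KEquiv m k P Q × KMinimal m k Q)
      × ((R : Word) → IsDyck m R → countS R ≡ (m + g * (m ∸ 1)) ∸ 1 →
         KEquiv m k P R → KMinimal m k R → R ≡ Q))
proposition3p14 (suc (suc m′)) (suc k′) _ (s≤s (s≤s z≤n)) (s≤s z≤n) P dP lenP =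
  let Q , dQ , lenQ , P~Q , ¬hQ = reachMinimal (countS P) (countS P * countS P) P dP refl (m≤m+n _ (area P))
  in Q , (dQ , trans lenQ lenP , P~Q , ¬HasSN^⇒KMinimal ¬hQ) ,
     λ R dR _ P~R minimalR →
       residues-injective (IsDyck⇒Blocks z<s dR) (IsDyck⇒Blocks z<s dQ) (IsDyck⇒Balanced dR) (IsDyck⇒Balanced dQ)
         (KMinimal⇒¬HasSN^ dR minimalR) ¬hQ
         (trans (sym (KEquiv-invariant (residues 0) residues-deleteN^K P~R)) (KEquiv-invariant (residues 0) residues-deleteN^K P~Q))
  where
  open Decompression m′ k′
  open Residues K
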